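{- Let $T$ be a tree on at least $3$ vertices, let $\ell\geq4$ and $t\geq4$. If $G$ is $T$-free (respectively $C_\ell$-free, respectively $\overline{P_t}$-free), then every complete expansion $\mathbb{K}[G](m_1,\dots,m_n)$ of $G$ is also $T$-free (respectively $C_\ell$-free, respectively $\overline{P_t}$-free).
   Context: All graphs are finite, simple and undirected. A graph is $F$-free if it has no induced subgraph isomorphic to $F$. $C_\ell$ is the cycle and $P_t$ the path on the given number of vertices; $\overline{F}$ denotes the complement. For a graph $G$ on vertices $v_1,\dots,v_n$ and positive integers $m_1,\dots,m_n$, the complete expansion $\mathbb{K}[G](m_1,\dots,m_n)$ is obtained by replacing each $v_i$ by a complete graph $K_{m_i}$ and joining every vertex of the $i$-th and $j$-th copies whenever $v_iv_j\in E(G)$. -}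

module Defs where

open import Data.Nat using (ℕ; zero; suc; _≤_; _∸_; _≡ᵇ_)
open import Data.Fin using (Fin; toℕ; _≟_)
open import Data.Bool using (Bool; true; false; _∧_; _∨_; not; if_then_else_)
open import Data.Product using (Σ; _×_; _,_)
open import Relation.Binary.PropositionalEquality using (_≡_)
open import Relation.Nullary using (¬_)
open import Relation.Nullary.Decidable using (⌊_⌋)
open import Function.Definitions using (Injective)

Graph : Set → Set
Graph V = V → V → Bool

Simple : {V : Set} → Graph V → Set
Simple {V} G = ((u v : V) → G u v ≡ G v u) × ((u : V) → G u u ≡ false)

distinct : {k : ℕ} → Fin k → Fin k → Bool
distinct i j = not ⌊ i ≟ j ⌋

Cycle : (ℓ : ℕ) → Graph (Fin ℓ)
Cycle ℓ i j = distinct i j ∧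
  ((suc (toℕ i) ≡ᵇ toℕ j) ∨ (suc (toℕ j) ≡ᵇ toℕ i)
   ∨ ((toℕ i ≡ᵇ 0) ∧ (toℕ j ≡ᵇ (ℓ ∸ 1)))
   ∨ ((toℕ j ≡ᵇ 0) ∧ (toℕ i ≡ᵇ (ℓ ∸ 1))))

Path : (t : ℕ) → Graph (Fin t)
Path t i j = (suc (toℕ i) ≡ᵇ toℕ j) ∨ (suc (toℕ j) ≡ᵇ toℕ i)

complement : {k : ℕ} → Graph (Fin k) → Graph (Fin k)
complement G i j = distinct i j ∧ not (G i j)

ContainsInduced : {V : Set} {k : ℕ} → Graph (Fin k) → Graph V → Set
ContainsInduced {V} {k} F G =
  Σ (Fin k → V) λ f → Injective _≡_ _≡_ f × ((i j : Fin k) → G (f i) (f j) ≡ F i j)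

Free : {V : Set} {k : ℕ} → Graph (Fin k) → Graph V → Set
Free F G = ¬ ContainsInduced F G

data Reach {k : ℕ} (G : Graph (Fin k)) (u : Fin k) : Fin k → Set where
  here : Reach G u u
  step : ∀ {v w} → Reach G u v → G v w ≡ true → Reach G u w

Connected : {k : ℕ} → Graph (Fin k) → Set
Connected {k} G = (u v : Fin k) → Reach G u v

Acyclic : {k : ℕ} → Graph (Fin k) → Set
Acyclic {k} G = (m : ℕ) → 3 ≤ m → (f : Fin m → Fin k) → Injective _≡_ _≡_ f →
  ¬ ((i j : Fin m) → Cycle m i j ≡ true → G (f i) (f j) ≡ true)

IsTree : {k : ℕ} → Graph (Fin k) → Set
IsTree G = Connected G × Acyclic G

-- Complete expansion K[G](m_1,…,m_n): vertex v_i is replaced by K_{m i}.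
ExpVertex : {n : ℕ} → (Fin n → ℕ) → Set
ExpVertex {n} m = Σ (Fin n) λ i → Fin (m i)

expansion : {n : ℕ} → Graph (Fin n) → (m : Fin n → ℕ) → Graph (ExpVertex m)
expansion G m (i , a) (j , b) =
  if ⌊ i ≟ j ⌋ then not (toℕ a ≡ᵇ toℕ b) else G i j

module Submission where

-- Call two vertices x, y of a graph *true twins* if they are distinct,
-- adjacent, and every other vertex is adjacent to both or to neither.  In a
-- complete expansion K[G](m₁,…,mₙ) two distinct vertices of the same bag K_{mᵢ}
-- are true twins, and an induced copy of F reflects true twins back into F.
-- Hence, if F has no true twins, an induced copy of F in the expansion meets
-- every bag at most once, and projecting each vertex to its bag gives an induced
-- copy of F in G itself.  So "F-free" passes from G to all its complete
-- expansions whenever F is true-twin-free (`twin-free-lift`).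
--
-- The rest of the file checks that the three families are true-twin-free:
--  * a tree on ≥ 3 vertices: twins i ~ j plus a walk to a third vertex yield a
--    common neighbour of i and j, i.e. a triangle;
--  * C_ℓ (ℓ ≥ 4) and the complement of P_t (t ≥ 4): both are graphs on the
--    labels 0,…,L-1 given by an arithmetic adjacency rule, and for every edge
--    we exhibit a label that is adjacent to exactly one of its endpoints.

open import Defs
open import Data.Nat using (ℕ; _≤_)
open import Data.Fin using (Fin)
open import Data.Product using (_×_)

open import Data.Nat using (zero; suc; _+_; _<_; _≡ᵇ_; _∸_; z≤n; s≤s)
open import Data.Nat.Properties
  using (≡ᵇ⇒≡; suc-injective; 1+n≢n; m≢1+n+m; <⇒≢; >⇒≢; <-trans; <-cmp; n<1+n; m≤n⇒m<n∨m≡n)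
  renaming (_≟_ to _≟ℕ_)
open import Data.Fin using (toℕ; fromℕ<; _≟_; punchIn; punchOut)
  renaming (zero to fzero; suc to fsuc)
open import Data.Fin.Properties
  using (toℕ-injective; toℕ-fromℕ<; toℕ<n; punchInᵢ≢i; punchIn-injective; punchIn-punchOut)
open import Data.Bool using (Bool; true; false; _∧_; _∨_; not; T)
open import Data.Bool.Properties using (∨-comm; ∨-zeroʳ; ∧-conicalˡ; ∧-conicalʳ; not-injective)
open import Data.Product using (Σ; _,_; proj₁)
open import Data.Sum using (_⊎_; inj₁; inj₂; [_,_])
open import Data.Empty using (⊥; ⊥-elim)
open import Data.Unit using (tt)
open import Function using (_∘_)
open import Function.Definitions using (Injective)
open import Relation.Binary using (tri<; tri≈; tri>)
open import Relation.Binary.PropositionalEquality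
  using (_≡_; _≢_; refl; sym; trans; cong; cong₂; subst; ≢-sym; module ≡-Reasoning)
open import Relation.Nullary using (¬_; Dec; yes; no)
open import Relation.Nullary.Decidable using (dec-true; dec-false; _⊎-dec_)
open import Relation.Unary using (Decidable)

open ≡-Reasoning

≡ᵇ-refl : ∀ n → (n ≡ᵇ n) ≡ true
≡ᵇ-refl n = dec-true (n ≟ℕ n) refl

≡ᵇ-false : ∀ {x y} → x ≢ y → (x ≡ᵇ y) ≡ false
≡ᵇ-false {x} {y} = dec-false (x ≟ℕ y)

≡ᵇ-sound : ∀ {x y} → (x ≡ᵇ y) ≡ true → x ≡ y
≡ᵇ-sound {x} {y} e = ≡ᵇ⇒≡ x y (subst T (sym e) tt)

≡ᵇ-sound-∧ : ∀ {a b c d} → ((a ≡ᵇ b) ∧ (c ≡ᵇ d)) ≡ true → a ≡ b × c ≡ d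
≡ᵇ-sound-∧ e = ≡ᵇ-sound (∧-conicalˡ _ _ e) , ≡ᵇ-sound (∧-conicalʳ _ _ e)

∨-cases : ∀ {a b} → a ∨ b ≡ true → a ≡ true ⊎ b ≡ true
∨-cases {true} _ = inj₁ refl
∨-cases {false} b = inj₂ b

∨-false : ∀ {a b} → a ≡ false → b ≡ false → a ∨ b ≡ false
∨-false refl refl = refl

∨-trueˡ : ∀ {a} b → a ≡ true → a ∨ b ≡ true
∨-trueˡ b refl = refl

∨-trueʳ : ∀ a {b} → b ≡ true → a ∨ b ≡ true
∨-trueʳ a refl = ∨-zeroʳ a

differ : ∀ {a b} → a ≡ true → b ≡ false → a ≢ b
differ refl refl ()

distinct-≢ : {k : ℕ} (i j : Fin k) → i ≢ j → distinct i j ≡ true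
distinct-≢ i j i≢j with i ≟ j
... | yes i≡j = ⊥-elim (i≢j i≡j)
... | no _ = refl

TrueTwins : {V : Set} → Graph V → V → V → Set
TrueTwins {V} H x y = x ≢ y × H x y ≡ true × ((z : V) → z ≢ x → z ≢ y → H x z ≡ H y z)

TrueTwinFree : {k : ℕ} → Graph (Fin k) → Set
TrueTwinFree {k} F = (i j : Fin k) → ¬ TrueTwins F i j

induced-reflects-twins : {V : Set} {k : ℕ} {F : Graph (Fin k)} {H : Graph V}
  (f : Fin k → V) → Injective _≡_ _≡_ f → ((i j : Fin k) → H (f i) (f j) ≡ F i j) →
  {i j : Fin k} → TrueTwins H (f i) (f j) → TrueTwins F i j
induced-reflects-twins {F = F} {H} f f-inj f-induced {i} {j} (fi≢fj , fi~fj , same) =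
  (λ i≡j → fi≢fj (cong f i≡j)) , trans (sym (f-induced i j)) fi~fj , same-in-F
  where
  same-in-F : (c : Fin _) → c ≢ i → c ≢ j → F i c ≡ F j c
  same-in-F c c≢i c≢j = begin
    F i c             ≡⟨ sym (f-induced i c) ⟩
    H (f i) (f c)     ≡⟨ same (f c) (λ e → c≢i (f-inj e)) (λ e → c≢j (f-inj e)) ⟩
    H (f j) (f c)     ≡⟨ f-induced j c ⟩
    F j c             ∎

module Expansion {n : ℕ} (G : Graph (Fin n)) (m : Fin n → ℕ) where

  bag-mates-adjacent : (x y : ExpVertex m) → proj₁ x ≡ proj₁ y → x ≢ y →
    expansion G m x y ≡ true
  bag-mates-adjacent (i , a) (.i , b) refl x≢y with i ≟ i
  ... | yes _ = cong not (≡ᵇ-false (λ e → x≢y (cong (i ,_) (toℕ-injective e))))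
  ... | no i≢i = ⊥-elim (i≢i refl)

  other-bags : (x y : ExpVertex m) → proj₁ x ≢ proj₁ y →
    expansion G m x y ≡ G (proj₁ x) (proj₁ y)
  other-bags (i , _) (j , _) i≢j with i ≟ j
  ... | yes i≡j = ⊥-elim (i≢j i≡j)
  ... | no _ = refl

  loopless : (x : ExpVertex m) → expansion G m x x ≡ false
  loopless (i , a) with i ≟ i
  ... | yes _ = cong not (≡ᵇ-refl (toℕ a))
  ... | no i≢i = ⊥-elim (i≢i refl)

  bag-mates-twins : (x y : ExpVertex m) → proj₁ x ≡ proj₁ y → x ≢ y →
    TrueTwins (expansion G m) x y
  bag-mates-twins x y same-bag x≢y =
    x≢y , bag-mates-adjacent x y same-bag x≢y , same-neighbours
    where
    same-neighbours : (z : ExpVertex m) → z ≢ x → z ≢ y →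
      expansion G m x z ≡ expansion G m y z
    same-neighbours z z≢x z≢y = by-bag-of-z (proj₁ x ≟ proj₁ z)
      where
      by-bag-of-z : Dec (proj₁ x ≡ proj₁ z) → expansion G m x z ≡ expansion G m y z
      by-bag-of-z (yes x-z) = trans (bag-mates-adjacent x z x-z (≢-sym z≢x))
        (sym (bag-mates-adjacent y z (trans (sym same-bag) x-z) (≢-sym z≢y)))
      by-bag-of-z (no x≁z) = trans (other-bags x z x≁z)
        (trans (cong (λ p → G p (proj₁ z)) same-bag)
          (sym (other-bags y z (λ y-z → x≁z (trans same-bag y-z)))))

-- An induced copy f in the
-- expansion uses each bag at most once, so its bag projection is a copy in G.
twin-free-lift : {n k : ℕ} (G : Graph (Fin n)) → Simple G → (m : Fin n → ℕ) →
  (F : Graph (Fin k)) → TrueTwinFree F → Free F G → Free F (expansion G m)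
twin-free-lift {k = k} G (_ , G-loopless) m F F-twin-free F-free (f , f-inj , f-induced) =
  F-free (bag-of , bag-of-inj , bag-of-induced)
  where
  open Expansion G m

  bag-of : Fin k → Fin _
  bag-of = proj₁ ∘ f

  bag-of-inj : Injective _≡_ _≡_ bag-of
  bag-of-inj {i} {j} same-bag with i ≟ j
  ... | yes i≡j = i≡j
  ... | no i≢j = ⊥-elim (F-twin-free i j (induced-reflects-twins {H = expansion G m} f f-inj f-induced
                   (bag-mates-twins (f i) (f j) same-bag (λ e → i≢j (f-inj e)))))

  bag-of-induced : (i j : Fin k) → G (bag-of i) (bag-of j) ≡ F i j
  bag-of-induced i j with i ≟ j
  ... | yes refl = trans (G-loopless (bag-of i)) (trans (sym (loopless (f i))) (f-induced i i))
  ... | no i≢j = trans (sym (other-bags (f i) (f j) (λ e → i≢j (bag-of-inj e)))) (f-induced i j)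

-- With at least three vertices, any two distinct vertices leave room for a
-- third: punch both out of Fin (3 + r) and take the first remaining vertex.
third-vertex : {k : ℕ} → 3 ≤ k → (i j : Fin k) → i ≢ j → Σ (Fin k) λ w → w ≢ i × w ≢ j
third-vertex (s≤s (s≤s (s≤s _))) i j i≢j = w , punchInᵢ≢i i _ , w≢j
  where
  j′ = punchOut i≢j
  w = punchIn i (punchIn j′ fzero)
  w≢j : w ≢ j
  w≢j w≡j = punchInᵢ≢i j′ fzero
    (punchIn-injective i _ _ (trans w≡j (sym (punchIn-punchOut i≢j))))

walk-leaves : {k : ℕ} (H : Graph (Fin k)) {P : Fin k → Set} → Decidable P →
  {u w : Fin k} → Reach H u w → P u → ¬ P w →
  Σ (Fin k) λ v → Σ (Fin k) λ v′ → P v × ¬ P v′ × H v v′ ≡ true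
walk-leaves H P? here Pu ¬Pw = ⊥-elim (¬Pw Pu)
walk-leaves H P? (step {v} {w} walk v~w) Pu ¬Pw with P? v
... | yes Pv = v , w , Pv , ¬Pw , v~w
... | no ¬Pv = walk-leaves H P? walk Pu ¬Pv

acyclic-triangle-free : {k : ℕ} (H : Graph (Fin k)) → ((u v : Fin k) → H u v ≡ H v u) →
  Acyclic H → (a b c : Fin k) → a ≢ b → b ≢ c → a ≢ c →
  H a b ≡ true → H b c ≡ true → H a c ≡ true → ⊥
acyclic-triangle-free {k} H H-sym acyclic a b c a≢b b≢c a≢c ab bc ac =
  acyclic 3 (s≤s (s≤s (s≤s z≤n))) corner corner-inj edges
  where
  corner : Fin 3 → Fin k
  corner fzero = a
  corner (fsuc fzero) = b
  corner (fsuc (fsuc fzero)) = c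

  corner-inj : Injective _≡_ _≡_ corner
  corner-inj {fzero} {fzero} _ = refl
  corner-inj {fzero} {fsuc fzero} e = ⊥-elim (a≢b e)
  corner-inj {fzero} {fsuc (fsuc fzero)} e = ⊥-elim (a≢c e)
  corner-inj {fsuc fzero} {fzero} e = ⊥-elim (a≢b (sym e))
  corner-inj {fsuc fzero} {fsuc fzero} _ = refl
  corner-inj {fsuc fzero} {fsuc (fsuc fzero)} e = ⊥-elim (b≢c e)
  corner-inj {fsuc (fsuc fzero)} {fzero} e = ⊥-elim (a≢c (sym e))
  corner-inj {fsuc (fsuc fzero)} {fsuc fzero} e = ⊥-elim (b≢c (sym e))
  corner-inj {fsuc (fsuc fzero)} {fsuc (fsuc fzero)} _ = refl

  edges : (p q : Fin 3) → Cycle 3 p q ≡ true → H (corner p) (corner q) ≡ true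
  edges fzero fzero ()
  edges fzero (fsuc fzero) _ = ab
  edges fzero (fsuc (fsuc fzero)) _ = ac
  edges (fsuc fzero) fzero _ = trans (H-sym b a) ab
  edges (fsuc fzero) (fsuc fzero) ()
  edges (fsuc fzero) (fsuc (fsuc fzero)) _ = bc
  edges (fsuc (fsuc fzero)) fzero _ = trans (H-sym c a) ac
  edges (fsuc (fsuc fzero)) (fsuc fzero) _ = trans (H-sym c b) bc
  edges (fsuc (fsuc fzero)) (fsuc (fsuc fzero)) ()

-- A tree on at least three vertices has no true twins: if i ~ j were twins,
-- a walk from i to a third vertex leaves {i, j} along an edge to some u, which
-- is then adjacent to both i and j, and i, j, u form a triangle.
tree-twin-free : {k : ℕ} (T : Graph (Fin k)) → Simple T → IsTree T → 3 ≤ k → TrueTwinFree T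
tree-twin-free {k} T (T-sym , _) (connected , acyclic) k≥3 i j (i≢j , i~j , twins)
  with third-vertex k≥3 i j i≢j
... | w , w≢i , w≢j
  with walk-leaves T (λ x → (x ≟ i) ⊎-dec (x ≟ j)) (connected i w) (inj₁ refl) [ w≢i , w≢j ]
... | v , u , v∈ij , u∉ij , v~u =
  acyclic-triangle-free T T-sym acyclic i j u i≢j (≢-sym u≢j) (≢-sym u≢i) i~j j~u i~u
  where
  u≢i : u ≢ i
  u≢i = u∉ij ∘ inj₁
  u≢j : u ≢ j
  u≢j = u∉ij ∘ inj₂

  i-sees-exit : (x : Fin k) → x ≡ i ⊎ x ≡ j → T x u ≡ true → T i u ≡ true
  i-sees-exit _ (inj₁ refl) x~u = x~u
  i-sees-exit _ (inj₂ refl) x~u = trans (twins u u≢i u≢j) x~u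

  i~u : T i u ≡ true
  i~u = i-sees-exit v v∈ij v~u
  j~u : T j u ≡ true
  j~u = trans (sym (twins u u≢i u≢j)) i~u

numbered : (L : ℕ) → (ℕ → ℕ → Bool) → Graph (Fin L)
numbered L h i j = distinct i j ∧ h (toℕ i) (toℕ j)

record Separator (L : ℕ) (h : ℕ → ℕ → Bool) (x y : ℕ) : Set where
  constructor separator
  field
    z : ℕ
    z<L : z < L
    z≢x : z ≢ x
    z≢y : z ≢ y
    distinguishes : h x z ≢ h y z

separator-sym : ∀ {L h x y} → Separator L h x y → Separator L h y x
separator-sym (separator z z<L z≢x z≢y d) = separator z z<L z≢y z≢x (≢-sym d)

separated⇒twin-free : (L : ℕ) (h : ℕ → ℕ → Bool) →
  ((x y : ℕ) → x < L → y < L → x ≢ y → h x y ≡ true → Separator L h x y) →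
  TrueTwinFree (numbered L h)
separated⇒twin-free L h separate i j (i≢j , i~j , twins) = distinguishes (begin
    h (toℕ i) z       ≡⟨ sym (towards-c i z≢x) ⟩
    numbered L h i c  ≡⟨ twins c (c≢ i z≢x) (c≢ j z≢y) ⟩
    numbered L h j c  ≡⟨ towards-c j z≢y ⟩
    h (toℕ j) z       ∎)
  where
  open Separator (separate (toℕ i) (toℕ j) (toℕ<n i) (toℕ<n j)
    (λ e → i≢j (toℕ-injective e)) (∧-conicalʳ _ _ i~j))

  c : Fin L
  c = fromℕ< z<L

  c≢ : (a : Fin L) → z ≢ toℕ a → c ≢ a
  c≢ a z≢a c≡a = z≢a (trans (sym (toℕ-fromℕ< z<L)) (cong toℕ c≡a))

  towards-c : (a : Fin L) → z ≢ toℕ a → numbered L h a c ≡ h (toℕ a) z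
  towards-c a z≢a = cong₂ _∧_ (distinct-≢ a c (≢-sym (c≢ a z≢a))) (cong (h (toℕ a)) (toℕ-fromℕ< z<L))

-- The adjacency rule of C_ℓ on labels (Cycle ℓ is numbered ℓ (cycleAdj ℓ)).
cycleAdj : ℕ → ℕ → ℕ → Bool
cycleAdj ℓ x y = (suc x ≡ᵇ y) ∨ (suc y ≡ᵇ x)
  ∨ ((x ≡ᵇ 0) ∧ (y ≡ᵇ (ℓ ∸ 1)))
  ∨ ((y ≡ᵇ 0) ∧ (x ≡ᵇ (ℓ ∸ 1)))

cycleAdj-cases : (ℓ x y : ℕ) → cycleAdj ℓ x y ≡ true →
  y ≡ suc x ⊎ x ≡ suc y ⊎ (x ≡ 0 × y ≡ ℓ ∸ 1) ⊎ (y ≡ 0 × x ≡ ℓ ∸ 1)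
cycleAdj-cases ℓ x y adj with ∨-cases adj
... | inj₁ e = inj₁ (sym (≡ᵇ-sound e))
... | inj₂ adj′ with ∨-cases adj′
...   | inj₁ e = inj₂ (inj₁ (sym (≡ᵇ-sound e)))
...   | inj₂ adj″ with ∨-cases adj″
...     | inj₁ e = inj₂ (inj₂ (inj₁ (≡ᵇ-sound-∧ e)))
...     | inj₂ e = inj₂ (inj₂ (inj₂ (≡ᵇ-sound-∧ e)))

-- An edge x ~ x+1 is separated by x+2 (adjacent to x+1 only), or, when x+1 is
-- the last label, by 0.  Here ℓ ≥ 4 keeps x+2 away from the neighbours of x.
successor-separator : (r x : ℕ) → suc x < 4 + r → Separator (4 + r) (cycleAdj (4 + r)) x (suc x)
successor-separator r x sx<L with m≤n⇒m<n∨m≡n sx<L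
... | inj₁ ssx<L = separator (suc (suc x)) ssx<L (≢-sym (m≢1+n+m x)) 1+n≢n
        (≢-sym (differ x+2-next-to-x+1 (two-apart-not-adjacent x)))
  where
  x+2-next-to-x+1 : cycleAdj (4 + r) (suc x) (suc (suc x)) ≡ true
  x+2-next-to-x+1 = ∨-trueˡ _ (≡ᵇ-refl x)

  two-apart-not-adjacent : (y : ℕ) → cycleAdj (4 + r) y (suc (suc y)) ≡ false
  two-apart-not-adjacent zero = refl
  two-apart-not-adjacent (suc y) =
    ∨-false (≡ᵇ-false {y} {suc y} (≢-sym 1+n≢n))
      (∨-false (≡ᵇ-false {suc (suc (suc y))} {y} (≢-sym (m≢1+n+m y {2}))) refl)
... | inj₂ ssx≡L with suc-injective (suc-injective ssx≡L)
...   | refl = separator 0 (s≤s z≤n) (λ ()) (λ ()) (≢-sym (differ last-next-to-0 last-not-next-to-0))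
  where
  last-not-next-to-0 : cycleAdj (4 + r) (2 + r) 0 ≡ false
  last-not-next-to-0 = ≡ᵇ-false {r} {suc r} (≢-sym 1+n≢n)

  last-next-to-0 : cycleAdj (4 + r) (3 + r) 0 ≡ true
  last-next-to-0 = ≡ᵇ-refl r

-- The wrap-around edge 0 ~ ℓ-1 is separated by 1, adjacent to 0 only.
wrap-separator : (r : ℕ) → Separator (4 + r) (cycleAdj (4 + r)) 0 (3 + r)
wrap-separator r = separator 1 (s≤s (s≤s z≤n)) (λ ()) (λ ()) (λ ())

cycle-twin-free : (ℓ : ℕ) → 4 ≤ ℓ → TrueTwinFree (Cycle ℓ)
cycle-twin-free (suc (suc (suc (suc r)))) (s≤s (s≤s (s≤s (s≤s _)))) =
  separated⇒twin-free (4 + r) (cycleAdj (4 + r)) edge-separator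
  where
  edge-separator : (x y : ℕ) → x < 4 + r → y < 4 + r → x ≢ y → cycleAdj (4 + r) x y ≡ true →
    Separator (4 + r) (cycleAdj (4 + r)) x y
  edge-separator x y x<L y<L _ x~y with cycleAdj-cases (4 + r) x y x~y
  ... | inj₁ refl = successor-separator r x y<L
  ... | inj₂ (inj₁ refl) = separator-sym (successor-separator r y x<L)
  ... | inj₂ (inj₂ (inj₁ (refl , refl))) = wrap-separator r
  ... | inj₂ (inj₂ (inj₂ (refl , refl))) = separator-sym (wrap-separator r)

pathAdj : ℕ → ℕ → Bool
pathAdj x y = (suc x ≡ᵇ y) ∨ (suc y ≡ᵇ x)

-- Complement edges x < y (so y ≠ x+1) are separated by a path-neighbour of
-- exactly one endpoint: x-1 if x > 0; otherwise 3 when y = 2, and 1 when y ≥ 3.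
gap-separator : (r x y : ℕ) → x < y → y < 4 + r → pathAdj x y ≡ false →
  Separator (4 + r) (λ a b → not (pathAdj a b)) x y
gap-separator r zero (suc zero) _ _ ()
gap-separator r zero (suc (suc zero)) _ _ _ =
  separator 3 (s≤s (s≤s (s≤s (s≤s z≤n)))) (λ ()) (λ ()) (λ ())
gap-separator r zero (suc (suc (suc y))) _ _ _ =
  separator 1 (s≤s (s≤s z≤n)) (λ ()) (λ ()) (λ ())
gap-separator r (suc x) y x<y y<L _ =
  separator x (<-trans (n<1+n x) (<-trans x<y y<L)) (≢-sym 1+n≢n) (<⇒≢ x<′y)
    (λ e → differ x-1-next-to-x x-1-not-next-to-y (not-injective e))
  where
  x<′y : x < y
  x<′y = <-trans (n<1+n x) x<y

  x-1-next-to-x : pathAdj (suc x) x ≡ true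
  x-1-next-to-x = ∨-trueʳ (suc (suc x) ≡ᵇ x) (≡ᵇ-refl x)

  x-1-not-next-to-y : pathAdj y x ≡ false
  x-1-not-next-to-y = ∨-false (≡ᵇ-false (>⇒≢ (<-trans x<′y (n<1+n y)))) (≡ᵇ-false (<⇒≢ x<y))

path-complement-twin-free : (t : ℕ) → 4 ≤ t → TrueTwinFree (complement (Path t))
path-complement-twin-free (suc (suc (suc (suc r)))) (s≤s (s≤s (s≤s (s≤s _)))) =
  separated⇒twin-free (4 + r) (λ a b → not (pathAdj a b)) edge-separator
  where
  edge-separator : (x y : ℕ) → x < 4 + r → y < 4 + r → x ≢ y → not (pathAdj x y) ≡ true →
    Separator (4 + r) (λ a b → not (pathAdj a b)) x y
  edge-separator x y x<L y<L x≢y x≁y with <-cmp x y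
  ... | tri< x<y _ _ = gap-separator r x y x<y y<L (not-injective {y = false} x≁y)
  ... | tri≈ _ x≡y _ = ⊥-elim (x≢y x≡y)
  ... | tri> _ _ y<x = separator-sym (gap-separator r y x y<x x<L
          (trans (∨-comm (suc y ≡ᵇ x) (suc x ≡ᵇ y)) (not-injective {y = false} x≁y)))

-- Each family is true-twin-free, so each freeness lifts by `twin-free-lift`.
proposition3p9 : {n : ℕ} (G : Graph (Fin n)) → Simple G →
    (m : Fin n → ℕ) → ((i : Fin n) → 1 ≤ m i) →
    ({k : ℕ} (T : Graph (Fin k)) → Simple T → IsTree T → 3 ≤ k →
        Free T G → Free T (expansion G m))
    × ((ℓ : ℕ) → 4 ≤ ℓ → Free (Cycle ℓ) G → Free (Cycle ℓ) (expansion G m))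
    × ((t : ℕ) → 4 ≤ t → Free (complement (Path t)) G →
        Free (complement (Path t)) (expansion G m))
proposition3p9 G G-simple m _ =
    (λ T T-simple T-tree k≥3 → lift T (tree-twin-free T T-simple T-tree k≥3))
  , (λ ℓ ℓ≥4 → lift (Cycle ℓ) (cycle-twin-free ℓ ℓ≥4))
  , (λ t t≥4 → lift (complement (Path t)) (path-complement-twin-free t t≥4))
  where
  lift : {k : ℕ} (F : Graph (Fin k)) → TrueTwinFree F → Free F G → Free F (expansion G m)
  lift = twin-free-lift G G-simple m
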